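{- Let $F$ and $G$ be forests on the vertex set $\mathcal N=\{1,\dots,N\}$, let $T^F$ be a tree of $F$ and $T^G$ a tree of $G$, and let $\mathcal D$ be one of the sets $\mathcal V T^F$, $\mathcal V T^F\cap\mathcal V T^G$, or $\mathcal V T^F\setminus\mathcal V T^G$. Then the $\mathcal D$-exchange of $F$ by $G$ and the $\mathcal D$-exchange of $G$ by $F$ are forests.
   Context: A forest is a digraph without directed circuits (loops count as circuits) in which every vertex has outdegree $0$ or $1$; its trees are its weakly connected components; $\mathcal V T$ denotes the vertex set of $T$. For digraphs $F,G$ on $\mathcal N$ and $\mathcal D\subseteq\mathcal N$, the $\mathcal D$-exchange of $F$ by $G$ is the digraph on $\mathcal N$ whose arcs are the arcs of $F$ with origin outside $\mathcal D$ together with the arcs of $G$ with origin in $\mathcal D$. -}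

module Defs where

open import Data.Nat using (ℕ)
open import Data.Fin using (Fin)
open import Data.Bool using (Bool; true; false; if_then_else_; _∧_; not)
open import Data.Product using (Σ; _×_)
open import Relation.Nullary using (¬_)
open import Relation.Binary.PropositionalEquality using (_≡_)
open import Relation.Binary.Construct.Closure.Transitive using (TransClosure)
open import Relation.Binary.Construct.Closure.Symmetric using (SymClosure)
open import Relation.Binary.Construct.Closure.ReflexiveTransitive using (Star)

-- A digraph on 𝒩 = Fin N, given by its (Boolean) adjacency:
-- A u v ≡ true  means there is an arc with origin u and terminus v.
Digraph : ℕ → Set
Digraph N = Fin N → Fin N → Bool

Arc : ∀ {N} → Digraph N → Fin N → Fin N → Set
Arc A u v = A u v ≡ true

VSet : ℕ → Set
VSet N = Fin N → Bool

_∈_ : ∀ {N} → Fin N → VSet N → Set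
v ∈ S = S v ≡ true

-- A directed circuit (loops count): a nonempty directed walk from some v back to v.
HasCircuit : ∀ {N} → Digraph N → Set
HasCircuit {N} A = Σ (Fin N) λ v → TransClosure (Arc A) v v

OutdegreeAtMostOne : ∀ {N} → Digraph N → Set
OutdegreeAtMostOne A = ∀ u v w → Arc A u v → Arc A u w → v ≡ w

IsForest : ∀ {N} → Digraph N → Set
IsForest A = ¬ HasCircuit A × OutdegreeAtMostOne A

WeaklyConnected : ∀ {N} → Digraph N → Fin N → Fin N → Set
WeaklyConnected A = Star (SymClosure (Arc A))

IsTreeVertexSet : ∀ {N} → Digraph N → VSet N → Set
IsTreeVertexSet {N} F T =
  Σ (Fin N) λ r → ∀ v → (v ∈ T → WeaklyConnected F r v) × (WeaklyConnected F r v → v ∈ T)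

exchange : ∀ {N} → VSet N → Digraph N → Digraph N → Digraph N
exchange D F G u v = if D u then G u v else F u v

_∩_ : ∀ {N} → VSet N → VSet N → VSet N
(A ∩ B) v = A v ∧ B v

_∖_ : ∀ {N} → VSet N → VSet N → VSet N
(A ∖ B) v = A v ∧ not (B v)

data AdmissibleD {N : ℕ} (TF TG : VSet N) : VSet N → Set where
  whole : AdmissibleD TF TG TF
  inter : AdmissibleD TF TG (TF ∩ TG)
  diff  : AdmissibleD TF TG (TF ∖ TG)

-- A tree of a forest is a weakly connected component, so its vertex set, and with it the
-- complement, is invariant along every arc of that forest.  Call a vertex set Q closed for a
-- digraph if no arc leaves it.  A circuit through a vertex of Q then stays in Q, and a circuit
-- through a vertex outside Q never enters Q, since it could not come back.
--
-- Let S be invariant under the arcs of A, T under those of B, and D = S ∩ T.  In the D-exchange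
-- of A by B the arcs leaving vertices outside S are A-arcs, so the complement of S is closed;
-- inside S the arcs leaving T are B-arcs, so T is closed there.  On each of the three resulting
-- pieces the exchange consists of arcs of a single forest, so a circuit of the exchange would
-- be a circuit of A or of B.  Every admissible D has this shape: TF = 𝒩 ∩ TF with 𝒩 invariant
-- under G, TF ∩ TG, and TF ∖ TG = TF ∩ ∁TG; the exchange of G by F is handled by swapping the
-- roles of the forests and commuting the intersection.
module Submission where

open import Defs
open import Data.Nat using (ℕ)
open import Data.Fin using (Fin)
open import Data.Bool using (true; false; not; _∧_; if_then_else_)
open import Data.Bool.Properties using (¬-not; ∧-comm) renaming (_≟_ to _≟ᵇ_)
open import Data.Product using (Σ; _×_; _,_; proj₁; proj₂; uncurry)
open import Function using (_∘_)
open import Level using (Level; 0ℓ)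
open import Relation.Nullary using (¬_; yes; no)
open import Relation.Unary using (Pred; Decidable; ∁)
open import Relation.Binary.Core using (Rel; _⇒_; _Preserves_⟶_)
open import Relation.Binary.Definitions using (_Respects_)
open import Relation.Binary.PropositionalEquality using (_≡_; refl; sym; trans; cong; cong₂; subst)
open import Relation.Binary.Construct.Closure.Transitive using (TransClosure; [_]; _∷_)
open import Relation.Binary.Construct.Closure.Symmetric using (fwd; bwd)
open import Relation.Binary.Construct.Closure.ReflexiveTransitive using (ε; _◅_; _◅◅_)

module _ {a ℓ : Level} {V : Set a} where

  Acyclic : Rel V ℓ → Set _
  Acyclic H = ¬ Σ V λ v → TransClosure H v v

  map⁺ : {H K : Rel V ℓ} → H ⇒ K → TransClosure H ⇒ TransClosure K
  map⁺ H⇒K [ h ]   = [ H⇒K h ]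
  map⁺ H⇒K (h ∷ p) = H⇒K h ∷ map⁺ H⇒K p

  acyclic-⊆ : {H K : Rel V ℓ} → H ⇒ K → Acyclic K → Acyclic H
  acyclic-⊆ H⇒K acyclic (v , circuit) = acyclic (v , map⁺ H⇒K circuit)

  _⇂_ : Rel V ℓ → Pred V ℓ → Rel V ℓ
  (H ⇂ Q) u w = Q u × H u w

  module _ {H : Rel V ℓ} {Q : Pred V ℓ} (closed : Q Respects H) where

    respects⁺ : Q Respects TransClosure H
    respects⁺ [ h ]   = closed h
    respects⁺ (h ∷ p) = respects⁺ p ∘ closed h

    stays-in : ∀ {x y} → Q x → TransClosure H x y → TransClosure (H ⇂ Q) x y
    stays-in Qx [ h ]   = [ Qx , h ]
    stays-in Qx (h ∷ p) = (Qx , h) ∷ stays-in (closed h Qx) p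

    stays-out : ∀ {x y} → ¬ Q y → TransClosure H x y → TransClosure (H ⇂ ∁ Q) x y
    stays-out ¬Qy [ h ]   = [ ¬Qy ∘ closed h , h ]
    stays-out ¬Qy (h ∷ p) = (¬Qy ∘ respects⁺ (h ∷ p) , h) ∷ stays-out ¬Qy p

    acyclic-by-parts : Decidable Q → Acyclic (H ⇂ Q) → Acyclic (H ⇂ ∁ Q) → Acyclic H
    acyclic-by-parts Q? acyclic-in acyclic-out (v , circuit) with Q? v
    ... | yes Qv = acyclic-in (v , stays-in Qv circuit)
    ... | no ¬Qv = acyclic-out (v , stays-out ¬Qv circuit)

module _ {N : ℕ} {A B : Digraph N} where

  exchange-arc : ∀ (D : VSet N) {c u w} → D u ≡ c →
    Arc (exchange D A B) u w → Arc (if c then B else A) u w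
  exchange-arc D {u = u} refl u→w with D u
  ... | true  = u→w
  ... | false = u→w

  exchange-cong : ∀ {D D′ : VSet N} → (∀ v → D v ≡ D′ v) →
    Arc (exchange D A B) ⇒ Arc (exchange D′ A B)
  exchange-cong D≗D′ {u} {w} = subst (λ d → (if d then B u w else A u w) ≡ true) (D≗D′ u)

  exchange-outdegree : ∀ (D : VSet N) → OutdegreeAtMostOne A → OutdegreeAtMostOne B →
    OutdegreeAtMostOne (exchange D A B)
  exchange-outdegree D outA outB u with D u
  ... | true  = outB u
  ... | false = outA u

  acyclic-where-constant : ∀ (D : VSet N) {c} {K : Rel (Fin N) 0ℓ} → Acyclic (Arc A) → Acyclic (Arc B) →
    (∀ {u w} → K u w → D u ≡ c × Arc (exchange D A B) u w) → Acyclic K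
  acyclic-where-constant D {c = false} acyclicA _ K⊆ = acyclic-⊆ (uncurry (exchange-arc D) ∘ K⊆) acyclicA
  acyclic-where-constant D {c = true}  _ acyclicB K⊆ = acyclic-⊆ (uncurry (exchange-arc D) ∘ K⊆) acyclicB

  module _ {S T : VSet N} (S-invariant : S Preserves Arc A ⟶ _≡_) (T-invariant : T Preserves Arc B ⟶ _≡_)
    (acyclicA : Acyclic (Arc A)) (acyclicB : Acyclic (Arc B)) where

    private
      H : Rel (Fin N) 0ℓ
      H = Arc (exchange (S ∩ T) A B)

      Outside-S : Pred (Fin N) 0ℓ
      Outside-S v = S v ≡ false

      In-T : Pred (Fin N) 0ℓ
      In-T v = T v ≡ true

      outside-S-closed : Outside-S Respects H
      outside-S-closed {u} u→w S≡f =
        trans (sym (S-invariant (exchange-arc (S ∩ T) (cong (_∧ T u) S≡f) u→w))) S≡f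

      T-closed-inside-S : In-T Respects (H ⇂ ∁ Outside-S)
      T-closed-inside-S (S≢f , u→w) T≡t =
        trans (sym (T-invariant (exchange-arc (S ∩ T) (cong₂ _∧_ (¬-not S≢f) T≡t) u→w))) T≡t

    acyclic-exchange-∩ : Acyclic (Arc (exchange (S ∩ T) A B))
    acyclic-exchange-∩ =
      acyclic-by-parts outside-S-closed (λ v → S v ≟ᵇ false)
        (acyclic-where-constant (S ∩ T) acyclicA acyclicB λ {u} (S≡f , u→w) → cong (_∧ T u) S≡f , u→w)
        (acyclic-by-parts T-closed-inside-S (λ v → T v ≟ᵇ true)
          (acyclic-where-constant (S ∩ T) acyclicA acyclicB λ (T≡t , S≢f , u→w) →
            cong₂ _∧_ (¬-not S≢f) T≡t , u→w)
          (acyclic-where-constant (S ∩ T) acyclicA acyclicB λ (T≢t , S≢f , u→w) →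
            cong₂ _∧_ (¬-not S≢f) (¬-not T≢t) , u→w))

  forest-exchange-∩ : ∀ {S T : VSet N} → IsForest A → IsForest B →
    S Preserves Arc A ⟶ _≡_ → T Preserves Arc B ⟶ _≡_ → IsForest (exchange (S ∩ T) A B)
  forest-exchange-∩ {S} {T} (acyclicA , outA) (acyclicB , outB) S-invariant T-invariant =
    acyclic-exchange-∩ S-invariant T-invariant acyclicA acyclicB , exchange-outdegree (S ∩ T) outA outB

forest-exchange-∩-swapped : ∀ {N} {A B : Digraph N} {S T : VSet N} → IsForest A → IsForest B →
  S Preserves Arc A ⟶ _≡_ → T Preserves Arc B ⟶ _≡_ → IsForest (exchange (S ∩ T) B A)
forest-exchange-∩-swapped {A = A} {B} {S} {T} forestA forestB S-invariant T-invariant =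
  acyclic-⊆ (exchange-cong {A = B} {A} (λ v → ∧-comm (S v) (T v))) (proj₁ forestT∩S) ,
  exchange-outdegree (S ∩ T) (proj₂ forestB) (proj₂ forestA)
  where
  forestT∩S : IsForest (exchange (T ∩ S) B A)
  forestT∩S = forest-exchange-∩ forestB forestA T-invariant S-invariant

true≡true⇒≡ : ∀ {x y} → (x ≡ true → y ≡ true) → (y ≡ true → x ≡ true) → x ≡ y
true≡true⇒≡ {false} {false} _   _   = refl
true≡true⇒≡ {false} {true}  _   y⇒x = y⇒x refl
true≡true⇒≡ {true}  {false} x⇒y _   = sym (x⇒y refl)
true≡true⇒≡ {true}  {true}  _   _   = refl

tree-invariant : ∀ {N} {F : Digraph N} {T : VSet N} → IsTreeVertexSet F T → T Preserves Arc F ⟶ _≡_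
tree-invariant (_ , component) u→w = true≡true⇒≡
  (λ u∈T → proj₂ (component _) (proj₁ (component _) u∈T ◅◅ fwd u→w ◅ ε))
  (λ w∈T → proj₂ (component _) (proj₁ (component _) w∈T ◅◅ bwd u→w ◅ ε))

mainTheorem16 : (N : ℕ) (F G : Digraph N) → IsForest F → IsForest G →
    (TF TG : VSet N) → IsTreeVertexSet F TF → IsTreeVertexSet G TG →
    (D : VSet N) → AdmissibleD TF TG D →
    IsForest (exchange D F G) × IsForest (exchange D G F)
mainTheorem16 N F G forestF forestG TF TG treeF treeG D whole =
  forest-exchange-∩-swapped forestG forestF (λ _ → refl) (tree-invariant treeF) ,
  forest-exchange-∩ forestG forestF (λ _ → refl) (tree-invariant treeF)
mainTheorem16 N F G forestF forestG TF TG treeF treeG D inter =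
  forest-exchange-∩ forestF forestG (tree-invariant treeF) (tree-invariant treeG) ,
  forest-exchange-∩-swapped forestF forestG (tree-invariant treeF) (tree-invariant treeG)
mainTheorem16 N F G forestF forestG TF TG treeF treeG D diff =
  forest-exchange-∩ forestF forestG (tree-invariant treeF) (cong not ∘ tree-invariant treeG) ,
  forest-exchange-∩-swapped forestF forestG (tree-invariant treeF) (cong not ∘ tree-invariant treeG)
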